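{- Let $G$ be a minimal subgraph of a pair $(G',D)$ in first standard form. Let $x,y_1,y_2\in V(G)\setminus D$ with $\{x,y_1\},\{x,y_2\}\in E(G)$ and $f(y_1)\neq f(x)\neq f(y_2)$. Then either one of $x,y_1,y_2$ is a cut vertex of $G$, or $f(y_1)\neq f(y_2)$.
   Context: All graphs are finite, simple, undirected. Bridgeless connected: connected and remains connected after deleting any one edge. $\gamma(G)$ is the domination number. Isolated triangle: for a graph $G$ with dominating set $D$, $\{u,v\}\subseteq V(G)\setminus D$ with $\{u,v\}\in E(G)$ and all neighbors of $u,v$ in $\{u,v,w\}$ for some $w\in D$ (associated with $w$). $(G',D)$ is in first standard form if: (1) $G'$ connected, simple, bridgeless; (2) $D$ dominating with $|D|=\gamma(G')$; (3) $D$ independent; (4) every $u\notin D$ has exactly one neighbor $f(u)$ in $D$; (5) no edge can be deleted keeping $G'$ connected, bridgeless and $D$ dominating; (6) if $|D|\ge2$ every vertex of $D$ is associated with exactly one isolated triangle, if $|D|=1$ with exactly two. A minimal subgraph of $(G',D)$ is a subgraph $G$ of $G'$ with (1) $D\subseteq V(G)$, (2) $G$ bridgeless connected, (3) $\{v,f(v)\}\in E(G)$ for all $v\in V(G)\setminus D$, (4) $G$ vertex- and edge-minimal with respect to (1)–(3). -}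

module Defs where

open import Data.Nat using (ℕ; zero; suc; _+_; _≤_)
open import Data.Fin using (Fin; _≟_)
import Data.Fin as Fin
open import Data.Bool using (Bool; true; false; _∧_; _∨_; not; T; if_then_else_)
open import Data.Product using (Σ; ∃; _×_; _,_)
open import Data.Sum using (_⊎_)
open import Data.Empty using (⊥)
open import Relation.Nullary using (¬_)
open import Relation.Nullary.Decidable using (⌊_⌋)
open import Relation.Binary.PropositionalEquality using (_≡_; _≢_)

record Gr (n : ℕ) : Set where
  field
    V : Fin n → Bool
    E : Fin n → Fin n → Bool
open Gr public

record WellFormed {n : ℕ} (G : Gr n) : Set where
  field
    E-sym : ∀ u v → E G u v ≡ E G v u
    E-irr : ∀ u → E G u u ≡ false
    E-V   : ∀ u v → T (E G u v) → T (V G u)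

_==_ : ∀ {n} → Fin n → Fin n → Bool
x == y = ⌊ x ≟ y ⌋

deleteEdge : ∀ {n} → Gr n → Fin n → Fin n → Gr n
deleteEdge G a b = record
  { V = V G
  ; E = λ x y → E G x y ∧ not ((x == a ∧ y == b) ∨ (x == b ∧ y == a)) }

deleteVertex : ∀ {n} → Gr n → Fin n → Gr n
deleteVertex G v = record
  { V = λ x → V G x ∧ not (x == v)
  ; E = λ x y → E G x y ∧ not (x == v) ∧ not (y == v) }

data Walk {n : ℕ} (G : Gr n) : Fin n → Fin n → Set where
  here : ∀ u → Walk G u u
  step : ∀ {u v w} → T (E G u v) → Walk G v w → Walk G u w

Connected : ∀ {n} → Gr n → Set
Connected G = ∀ u v → T (V G u) → T (V G v) → Walk G u v

BridgelessConnected : ∀ {n} → Gr n → Set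
BridgelessConnected G =
  Connected G × (∀ u v → T (E G u v) → Connected (deleteEdge G u v))

CutVertex : ∀ {n} → Gr n → Fin n → Set
CutVertex G v = T (V G v) × ¬ Connected (deleteVertex G v)

Subgraph : ∀ {n} → Gr n → Gr n → Set
Subgraph H G = (∀ x → T (V H x) → T (V G x)) × (∀ x y → T (E H x y) → T (E G x y))

SameGraph : ∀ {n} → Gr n → Gr n → Set
SameGraph H G = (∀ x → V H x ≡ V G x) × (∀ x y → E H x y ≡ E G x y)

card : ∀ {n} → (Fin n → Bool) → ℕ
card {zero}  D = 0
card {suc n} D = (if D Fin.zero then 1 else 0) + card (λ i → D (Fin.suc i))

Dominating : ∀ {n} → Gr n → (Fin n → Bool) → Set
Dominating G D =
  (∀ v → T (D v) → T (V G v)) ×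
  (∀ v → T (V G v) → T (D v) ⊎ ∃ λ w → T (D w) × T (E G v w))

MinimumDominating : ∀ {n} → Gr n → (Fin n → Bool) → Set
MinimumDominating G D = Dominating G D × (∀ D' → Dominating G D' → card D ≤ card D')

Independent : ∀ {n} → Gr n → (Fin n → Bool) → Set
Independent G D = ∀ u v → T (D u) → T (D v) → ¬ T (E G u v)

IsolatedTriangle : ∀ {n} → Gr n → (Fin n → Bool) → Fin n → Fin n → Fin n → Set
IsolatedTriangle G D w u v =
  T (D w) × ¬ T (D u) × ¬ T (D v) × T (V G u) × T (V G v) × T (E G u v) ×
  (∀ z → T (E G u z) → z ≡ u ⊎ z ≡ v ⊎ z ≡ w) ×
  (∀ z → T (E G v z) → z ≡ u ⊎ z ≡ v ⊎ z ≡ w)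

SamePair : ∀ {n} → Fin n → Fin n → Fin n → Fin n → Set
SamePair u v u' v' = (u ≡ u' × v ≡ v') ⊎ (u ≡ v' × v ≡ u')

ExactlyOneIsoTri : ∀ {n} → Gr n → (Fin n → Bool) → Fin n → Set
ExactlyOneIsoTri G D w =
  ∃ λ u → ∃ λ v → IsolatedTriangle G D w u v ×
    (∀ u' v' → IsolatedTriangle G D w u' v' → SamePair u v u' v')

ExactlyTwoIsoTri : ∀ {n} → Gr n → (Fin n → Bool) → Fin n → Set
ExactlyTwoIsoTri G D w =
  ∃ λ u₁ → ∃ λ v₁ → ∃ λ u₂ → ∃ λ v₂ →
    IsolatedTriangle G D w u₁ v₁ × IsolatedTriangle G D w u₂ v₂ ×
    ¬ SamePair u₁ v₁ u₂ v₂ ×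
    (∀ u' v' → IsolatedTriangle G D w u' v' →
       SamePair u₁ v₁ u' v' ⊎ SamePair u₂ v₂ u' v')

record FirstStandardForm {n : ℕ} (G' : Gr n) (D : Fin n → Bool) : Set where
  field
    simple      : WellFormed G'
    allVertices : ∀ v → T (V G' v)
    bridgeless  : BridgelessConnected G'
    minDom      : MinimumDominating G' D
    indep       : Independent G' D
    uniqueDomNb : ∀ u → ¬ T (D u) →
                    ∃ λ w → (T (D w) × T (E G' u w)) ×
                      (∀ w' → T (D w') → T (E G' u w') → w' ≡ w)
    edgeMinimal : ∀ a b → T (E G' a b) →
                    ¬ (BridgelessConnected (deleteEdge G' a b) ×
                       Dominating (deleteEdge G' a b) D)
    isoTri2     : 2 ≤ card D → ∀ w → T (D w) → ExactlyOneIsoTri G' D w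
    isoTri1     : card D ≡ 1 → ∀ w → T (D w) → ExactlyTwoIsoTri G' D w

IsDomFun : ∀ {n} → Gr n → (Fin n → Bool) → (Fin n → Fin n) → Set
IsDomFun G' D f = ∀ u → ¬ T (D u) → T (D (f u)) × T (E G' u (f u))

MinSubCond : ∀ {n} → Gr n → (Fin n → Bool) → (Fin n → Fin n) → Gr n → Set
MinSubCond G' D f G =
  WellFormed G × Subgraph G G' ×
  (∀ v → T (D v) → T (V G v)) ×
  BridgelessConnected G ×
  (∀ v → T (V G v) → ¬ T (D v) → T (E G v (f v)))

MinimalSubgraph : ∀ {n} → Gr n → (Fin n → Bool) → (Fin n → Fin n) → Gr n → Set
MinimalSubgraph G' D f G =
  MinSubCond G' D f G ×
  (∀ H → Subgraph H G → MinSubCond G' D f H → SameGraph H G)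

-- Suppose f(y₁) = f(y₂) = w and put w' = f(x) ≠ w, and suppose neither x
-- nor y₁ is a cut vertex.  A walk from w' to w in G − x first enters
-- {y₁, y₂, w} at some t, coming from a "detour" that avoids x, y₁, y₂, w.
-- Together with the 4-cycle x y₁ w y₂ this detour gives enough edge-disjoint
-- routes to show that G − xy₁ (if t = y₁), G − xy₂ (if t = y₂), or, if t = w,
-- either G − xy₁ or G − y₁ (when y₁ has degree 2) is still bridgeless
-- connected.  Each contradicts the minimality of G, since x, y₁, y₂ ∉ D.
module Submission where

open import Defs
open import Data.Nat using (ℕ; zero; suc; _≤_; _<_; z≤n; s≤s)
open import Data.Nat.Properties using (≤-trans; m≤n⇒m≤1+n; <⇒≱)
open import Data.Fin using (Fin; _≟_) renaming (zero to fzero; suc to fsuc)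
open import Data.Fin.Properties using (all?; any?; ¬∀⟶∃¬)
open import Data.Bool using (Bool; true; false; T; _∧_; _∨_; not)
open import Data.Bool.Properties using (∧-comm; ∨-comm)
open import Data.Product using (Σ; _×_; _,_; proj₁; proj₂)
open import Data.Sum using (_⊎_; inj₁; inj₂; [_,_])
open import Data.Empty using (⊥; ⊥-elim)
open import Data.Unit using (tt)
open import Relation.Nullary using (¬_; Dec; yes; no)
open import Relation.Nullary.Decidable
  using (⌊_⌋; toWitness; fromWitness; T?; ¬?; _→-dec_; _×-dec_; _⊎-dec_)
open import Relation.Binary.PropositionalEquality
  using (_≡_; _≢_; refl; sym; trans; cong; cong₂; subst; ≢-sym)

∧-intro : ∀ {a b} → T a → T b → T (a ∧ b)
∧-intro {true} _ tb = tb

∧-l : ∀ {a b} → T (a ∧ b) → T a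
∧-l {true} _ = tt

∧-r : ∀ {a b} → T (a ∧ b) → T b
∧-r {true} t = t

∨-inl : ∀ {a b} → T a → T (a ∨ b)
∨-inl {true} _ = tt

∨-inr : ∀ {a b} → T b → T (a ∨ b)
∨-inr {true} _ = tt
∨-inr {false} t = t

∨-elim : ∀ {a b} → T (a ∨ b) → T a ⊎ T b
∨-elim {true} _ = inj₁ tt
∨-elim {false} t = inj₂ t

not-intro : ∀ {a} → ¬ T a → T (not a)
not-intro {true} h = h tt
not-intro {false} _ = tt

not-elim : ∀ {a} → T (not a) → ¬ T a
not-elim {true} ()
not-elim {false} _ ()

==-intro : ∀ {n} {x y : Fin n} → x ≡ y → T (x == y)
==-intro {x = x} {y} = fromWitness {a? = x ≟ y}

==-elim : ∀ {n} {x y : Fin n} → T (x == y) → x ≡ y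
==-elim {x = x} {y} = toWitness {a? = x ≟ y}

EdgeNe : ∀ {n} → Fin n → Fin n → Fin n → Fin n → Set
EdgeNe p q a b = ¬ (p ≡ a × q ≡ b) × ¬ (p ≡ b × q ≡ a)

edge-trichotomy : ∀ {n} (p q a b : Fin n) →
  (p ≡ a × q ≡ b) ⊎ (p ≡ b × q ≡ a) ⊎ EdgeNe p q a b
edge-trichotomy p q a b with (p ≟ a ×-dec q ≟ b) | (p ≟ b ×-dec q ≟ a)
... | yes same | _        = inj₁ same
... | no _     | yes rev  = inj₂ (inj₁ rev)
... | no ne₁   | no ne₂   = inj₂ (inj₂ (ne₁ , ne₂))

module _ {n} {p q a b : Fin n} where

  edgeNe-comm : EdgeNe p q a b → EdgeNe a b p q
  edgeNe-comm (ne₁ , ne₂) =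
    (λ { (e₁ , e₂) → ne₁ (sym e₁ , sym e₂) }) , (λ { (e₁ , e₂) → ne₂ (sym e₂ , sym e₁) })

  edgeNe-fst : p ≢ a → p ≢ b → EdgeNe p q a b
  edgeNe-fst p≢a p≢b = (λ h → p≢a (proj₁ h)) , (λ h → p≢b (proj₁ h))

  edgeNe-snd : q ≢ a → q ≢ b → EdgeNe p q a b
  edgeNe-snd q≢a q≢b = (λ h → q≢b (proj₂ h)) , (λ h → q≢a (proj₂ h))

  edgeNe-outside : (Z : Fin n → Set) → ¬ Z p → ¬ Z q → Z a ⊎ Z b → EdgeNe p q a b
  edgeNe-outside Z ¬Zp ¬Zq (inj₁ Za) =
    (λ h → ¬Zp (subst Z (sym (proj₁ h)) Za)) , (λ h → ¬Zq (subst Z (sym (proj₂ h)) Za))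
  edgeNe-outside Z ¬Zp ¬Zq (inj₂ Zb) =
    (λ h → ¬Zq (subst Z (sym (proj₂ h)) Zb)) , (λ h → ¬Zp (subst Z (sym (proj₁ h)) Zb))

edgeNe-touching : ∀ {n} {p q a b : Fin n} (Z : Fin n → Set) →
  Z p ⊎ Z q → ¬ Z a → ¬ Z b → EdgeNe p q a b
edgeNe-touching Z Zpq ¬Za ¬Zb = edgeNe-comm (edgeNe-outside Z ¬Za ¬Zb Zpq)

module _ {n} (K : Gr n) (a b : Fin n) where

  delE-intro : ∀ {u v} → T (E K u v) → EdgeNe u v a b → T (E (deleteEdge K a b) u v)
  delE-intro {u} {v} e (ne₁ , ne₂) =
    ∧-intro e (not-intro λ t → notDeleted (∨-elim {u == a ∧ v == b} t))
    where
    notDeleted : T (u == a ∧ v == b) ⊎ T (u == b ∧ v == a) → ⊥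
    notDeleted (inj₁ t) = ne₁ (==-elim (∧-l {u == a} t) , ==-elim (∧-r {u == a} t))
    notDeleted (inj₂ t) = ne₂ (==-elim (∧-l {u == b} t) , ==-elim (∧-r {u == b} t))

  delE-E : ∀ {u v} → T (E (deleteEdge K a b) u v) → T (E K u v)
  delE-E {u} {v} = ∧-l {E K u v}

  delE-ne : ∀ {u v} → T (E (deleteEdge K a b) u v) → EdgeNe u v a b
  delE-ne {u} {v} t =
    (λ { (p , q) → not-elim (∧-r {E K u v} t) (∨-inl (∧-intro (==-intro p) (==-intro q))) }) ,
    (λ { (p , q) → not-elim (∧-r {E K u v} t)
                     (∨-inr {u == a ∧ v == b} (∧-intro (==-intro p) (==-intro q))) })

module _ {n} (K : Gr n) (y : Fin n) where

  delV-intro : ∀ {u v} → T (E K u v) → u ≢ y → v ≢ y → T (E (deleteVertex K y) u v)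
  delV-intro e u≢y v≢y =
    ∧-intro e (∧-intro (not-intro λ t → u≢y (==-elim t)) (not-intro λ t → v≢y (==-elim t)))

  delV-E : ∀ {u v} → T (E (deleteVertex K y) u v) → T (E K u v)
  delV-E {u} {v} = ∧-l {E K u v}

  delV-ne₁ : ∀ {u v} → T (E (deleteVertex K y) u v) → u ≢ y
  delV-ne₁ {u} {v} t p = not-elim (∧-l {not (u == y)} (∧-r {E K u v} t)) (==-intro p)

  delV-ne₂ : ∀ {u v} → T (E (deleteVertex K y) u v) → v ≢ y
  delV-ne₂ {u} {v} t p = not-elim (∧-r {not (u == y)} (∧-r {E K u v} t)) (==-intro p)

  delV-Vintro : ∀ {u} → T (V K u) → u ≢ y → T (V (deleteVertex K y) u)
  delV-Vintro t u≢y = ∧-intro t (not-intro λ s → u≢y (==-elim s))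

  delV-V : ∀ {u} → T (V (deleteVertex K y) u) → T (V K u)
  delV-V {u} = ∧-l {V K u}

  delV-Vne : ∀ {u} → T (V (deleteVertex K y) u) → u ≢ y
  delV-Vne {u} t p = not-elim (∧-r {V K u} t) (==-intro p)

delEE-intro : ∀ {n} (K : Gr n) {c d a b p q} → T (E K p q) → EdgeNe p q c d → EdgeNe p q a b →
  T (E (deleteEdge (deleteEdge K c d) a b) p q)
delEE-intro K {c} {d} {a} {b} e ne-cd ne-ab =
  delE-intro (deleteEdge K c d) a b (delE-intro K c d e ne-cd) ne-ab

delVE-intro : ∀ {n} (K : Gr n) {y a b p q} → T (E K p q) → p ≢ y → q ≢ y → EdgeNe p q a b →
  T (E (deleteEdge (deleteVertex K y) a b) p q)
delVE-intro K {y} {a} {b} e p≢y q≢y ne =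
  delE-intro (deleteVertex K y) a b (delV-intro K y e p≢y q≢y) ne

wfDelE : ∀ {n} {K : Gr n} a b → WellFormed K → WellFormed (deleteEdge K a b)
wfDelE {K = K} a b wf = record
  { E-sym = λ u v → cong₂ _∧_ (E-sym u v)
      (cong not (trans (∨-comm (u == a ∧ v == b) (u == b ∧ v == a))
                       (cong₂ _∨_ (∧-comm (u == b) (v == a)) (∧-comm (u == a) (v == b)))))
  ; E-irr = λ u → cong (λ z → z ∧ _) (E-irr u)
  ; E-V   = λ u v t → E-V u v (∧-l {E K u v} t) }
  where open WellFormed wf

wfDelV : ∀ {n} {K : Gr n} y → WellFormed K → WellFormed (deleteVertex K y)
wfDelV {K = K} y wf = record
  { E-sym = λ u v → cong₂ _∧_ (E-sym u v) (∧-comm (not (u == y)) (not (v == y)))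
  ; E-irr = λ u → cong (λ z → z ∧ _) (E-irr u)
  ; E-V   = λ u v t → ∧-intro (E-V u v (∧-l {E K u v} t)) (∧-l {not (u == y)} (∧-r {E K u v} t)) }
  where open WellFormed wf

Sym : ∀ {n} → Gr n → Set
Sym K = ∀ {u v} → T (E K u v) → T (E K v u)

symmetric : ∀ {n} {K : Gr n} → WellFormed K → Sym K
symmetric wf {u} {v} = subst T (WellFormed.E-sym wf u v)

_++_ : ∀ {n} {K : Gr n} {a b c} → Walk K a b → Walk K b c → Walk K a c
here _   ++ W = W
step e r ++ W = step e (r ++ W)

snoc : ∀ {n} {K : Gr n} {a b c} → Walk K a b → T (E K b c) → Walk K a c
snoc W e = W ++ step e (here _)

rev : ∀ {n} {K : Gr n} → Sym K → ∀ {a b} → Walk K a b → Walk K b a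
rev s (here _)   = here _
rev s (step e r) = snoc (rev s r) (s e)

mono : ∀ {n} {A B : Gr n} → (∀ {u v} → T (E A u v) → T (E B u v)) →
  ∀ {a b} → Walk A a b → Walk B a b
mono h (here _)   = here _
mono h (step e r) = step (h e) (mono h r)

rerouteEdge : ∀ {n} {K L : Gr n} {c d} → Sym L →
  (∀ {p q} → T (E K p q) → EdgeNe p q c d → T (E L p q)) →
  Walk L c d → ∀ {u v} → Walk K u v → Walk L u v
rerouteEdge sL keep W (here _) = here _
rerouteEdge {c = c} {d} sL keep W (step {p} {q} e r) with edge-trichotomy p q c d
... | inj₁ (refl , refl)        = W ++ rerouteEdge sL keep W r
... | inj₂ (inj₁ (refl , refl)) = rev sL W ++ rerouteEdge sL keep W r
... | inj₂ (inj₂ ne)            = step (keep e ne) (rerouteEdge sL keep W r)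

module RerouteVertex {n} {K L : Gr n} {y a b : Fin n} (sK : Sym K) (sL : Sym L)
  (keep : ∀ {p q} → T (E K p q) → p ≢ y → q ≢ y → T (E L p q))
  (nbrs : ∀ {z} → T (E K y z) → z ≡ a ⊎ z ≡ b) (a≢y : a ≢ y) (b≢y : b ≢ y)
  (W : Walk L a b) where

  private
    between : ∀ {u v} → (u ≡ a ⊎ u ≡ b) → (v ≡ a ⊎ v ≡ b) → Walk L u v
    between (inj₁ refl) (inj₁ refl) = here _
    between (inj₁ refl) (inj₂ refl) = W
    between (inj₂ refl) (inj₁ refl) = rev sL W
    between (inj₂ refl) (inj₂ refl) = here _

    nbr≢y : ∀ {v} → (v ≡ a ⊎ v ≡ b) → v ≢ y
    nbr≢y (inj₁ refl) = a≢y
    nbr≢y (inj₂ refl) = b≢y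

  reroute : ∀ {u v} → u ≢ y → v ≢ y → Walk K u v → Walk L u v
  reroute u≢y v≢y (here _) = here _
  reroute u≢y v≢y (step {_} {c} e r) with c ≟ y
  ... | no c≢y = step (keep e u≢y c≢y) (reroute c≢y v≢y r)
  reroute u≢y v≢y (step e (here _))      | yes refl = ⊥-elim (v≢y refl)
  reroute u≢y v≢y (step e (step e' r))   | yes refl =
    between (nbrs (sK e)) (nbrs e') ++ reroute (nbr≢y (nbrs e')) v≢y r

bridgeless-deleteEdge : ∀ {n} {G : Gr n} {c d} → WellFormed G → BridgelessConnected G →
  T (E G c d) →
  (∀ a b → T (E G a b) → Walk (deleteEdge (deleteEdge G c d) a b) c d) →
  BridgelessConnected (deleteEdge G c d)
bridgeless-deleteEdge {G = G} {c} {d} wf (_ , bc) cd route =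
  bc c d cd , λ a b ab u v Vu Vv →
    rerouteEdge (symmetric (wfDelE a b (wfDelE c d wf))) (keep a b)
      (route a b (delE-E G c d ab)) (bc a b (delE-E G c d ab) u v Vu Vv)
  where
  keep : ∀ a b {p q} → T (E (deleteEdge G a b) p q) → EdgeNe p q c d →
    T (E (deleteEdge (deleteEdge G c d) a b) p q)
  keep a b e ne = delEE-intro G (delE-E G a b e) ne (delE-ne G a b e)

bridgeless-deleteVertex : ∀ {n} {G : Gr n} {y a b} → WellFormed G → BridgelessConnected G →
  (∀ {z} → T (E G y z) → z ≡ a ⊎ z ≡ b) → a ≢ y → b ≢ y →
  Connected (deleteVertex G y) →
  (∀ p q → T (E G p q) → Walk (deleteEdge (deleteVertex G y) p q) a b) →
  BridgelessConnected (deleteVertex G y)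
bridgeless-deleteVertex {G = G} {y} wf (_ , bc) nbrs a≢y b≢y connected route =
  connected , λ p q pq u v Vu Vv →
    let pqG = delV-E G y pq
        open RerouteVertex (symmetric (wfDelE p q wf)) (symmetric (wfDelE p q (wfDelV y wf)))
               (keep p q) (λ e → nbrs (delE-E G p q e)) a≢y b≢y (route p q pqG)
    in reroute (delV-Vne G y Vu) (delV-Vne G y Vv)
         (bc p q pqG u v (delV-V G y Vu) (delV-V G y Vv))
  where
  keep : ∀ p q {r s} → T (E (deleteEdge G p q) r s) → r ≢ y → s ≢ y →
    T (E (deleteEdge (deleteVertex G y) p q) r s)
  keep p q e r≢y s≢y = delVE-intro G (delE-E G p q e) r≢y s≢y (delE-ne G p q e)

card-≤ : ∀ {n} (A : Fin n → Bool) → card A ≤ n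
card-≤ {zero} A = z≤n
card-≤ {suc n} A with A fzero
... | true  = s≤s (card-≤ _)
... | false = m≤n⇒m≤1+n (card-≤ _)

card-mono : ∀ {n} (A B : Fin n → Bool) → (∀ i → T (A i) → T (B i)) → card A ≤ card B
card-mono {zero} A B h = z≤n
card-mono {suc n} A B h with A fzero in eA | B fzero in eB
... | true  | true  = s≤s (card-mono _ _ (λ i → h (fsuc i)))
... | true  | false = ⊥-elim (subst T eB (h fzero (subst T (sym eA) tt)))
... | false | true  = m≤n⇒m≤1+n (card-mono _ _ (λ i → h (fsuc i)))
... | false | false = card-mono _ _ (λ i → h (fsuc i))

card-strict : ∀ {n} (A B : Fin n → Bool) → (∀ i → T (A i) → T (B i)) →
  ∀ i → T (B i) → ¬ T (A i) → card A < card B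
card-strict {suc n} A B h fzero Bi ¬Ai with A fzero in eA | B fzero in eB
... | true  | _     = ⊥-elim (¬Ai tt)
... | false | false = ⊥-elim Bi
... | false | true  = s≤s (card-mono _ _ (λ i → h (fsuc i)))
card-strict {suc n} A B h (fsuc i) Bi ¬Ai with A fzero in eA | B fzero in eB
... | true  | true  = s≤s (card-strict _ _ (λ i → h (fsuc i)) i Bi ¬Ai)
... | true  | false = ⊥-elim (subst T eB (h fzero (subst T (sym eA) tt)))
... | false | true  = m≤n⇒m≤1+n (card-strict _ _ (λ i → h (fsuc i)) i Bi ¬Ai)
... | false | false = card-strict _ _ (λ i → h (fsuc i)) i Bi ¬Ai

card-pos : ∀ {n} (A : Fin n → Bool) → ∀ i → T (A i) → 0 < card A
card-pos {suc n} A fzero t with A fzero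
... | true  = s≤s z≤n
... | false = ⊥-elim t
card-pos {suc n} A (fsuc i) t with A fzero
... | true  = s≤s z≤n
... | false = card-pos _ i t

-- Decidability of reachability, by saturation: R k is the set of vertices
-- reachable from s by walks of length at most k.  The sets grow strictly until
-- they stabilise, so they are stable after n steps; a stable set is closed
-- under edges and hence contains every vertex reachable from s.
module Reachability {n} (K : Gr n) (s : Fin n) where

  R : ℕ → Fin n → Bool
  R zero    v = v == s
  R (suc k) v = R k v ∨ ⌊ any? (λ z → T? (R k z ∧ E K z v)) ⌋

  sound : ∀ k v → T (R k v) → Walk K s v
  sound zero v t = subst (Walk K s) (sym (==-elim t)) (here s)
  sound (suc k) v t with ∨-elim t
  ... | inj₁ t' = sound k v t'
  ... | inj₂ t' with toWitness t'
  ... | z , Rz∧zv = snoc (sound k z (∧-l Rz∧zv)) (∧-r Rz∧zv)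

  Stable : ℕ → Set
  Stable k = ∀ v → T (R (suc k) v) → T (R k v)

  s∈R : ∀ k → T (R k s)
  s∈R zero    = ==-intro refl
  s∈R (suc k) = ∨-inl (s∈R k)

  Progress : ℕ → Set
  Progress k = (Σ ℕ λ j → Stable j × (∀ v → T (R j v) → T (R k v))) ⊎ k < card (R k)

  progress : ∀ k → Progress k
  progress zero = inj₂ (card-pos (R 0) s (s∈R 0))
  progress (suc k) with progress k
  ... | inj₁ (j , st , ⊆) = inj₁ (j , st , λ v t → ∨-inl (⊆ v t))
  ... | inj₂ k<card with all? (λ v → T? (R (suc k) v) →-dec T? (R k v))
  ... | yes st = inj₁ (k , st , λ v t → ∨-inl t)
  ... | no ¬st with ¬∀⟶∃¬ n _ (λ v → T? (R (suc k) v) →-dec T? (R k v)) ¬st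
  ... | v , ¬grows =
    inj₂ (≤-trans (s≤s k<card) (card-strict (R k) (R (suc k)) (λ i t → ∨-inl t) v new old))
    where
    new : T (R (suc k) v)
    new with T? (R (suc k) v)
    ... | yes t = t
    ... | no ¬t = ⊥-elim (¬grows (λ t → ⊥-elim (¬t t)))
    old : ¬ T (R k v)
    old t = ¬grows (λ _ → t)

  stable : Σ ℕ λ j → Stable j × (∀ v → T (R j v) → T (R n v))
  stable with progress n
  ... | inj₁ r    = r
  ... | inj₂ n<card = ⊥-elim (<⇒≱ n<card (card-≤ (R n)))

  closed : ∀ {a v} → T (R (proj₁ stable) a) → Walk K a v → T (R (proj₁ stable) v)
  closed t (here _) = t
  closed {a} t (step {_} {c} e r) =
    closed (proj₁ (proj₂ stable) c
             (∨-inr {R j c} (fromWitness {a? = any? (λ z → T? (R j z ∧ E K z c))} (a , ∧-intro t e))))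
           r
    where j = proj₁ stable

  walk? : ∀ v → Dec (Walk K s v)
  walk? v with T? (R n v)
  ... | yes t = yes (sound n v t)
  ... | no ¬t = no (λ W → ¬t (proj₂ (proj₂ stable) v (closed (s∈R (proj₁ stable)) W)))

connected? : ∀ {n} (K : Gr n) → Dec (Connected K)
connected? K =
  all? (λ u → all? (λ v → T? (V K u) →-dec (T? (V K v) →-dec Reachability.walk? K u v)))

restrict : ∀ {n} → Gr n → (Fin n → Bool) → Gr n
restrict K S = record { V = V K ; E = λ u v → E K u v ∧ not (S u) ∧ not (S v) }

restrict-E : ∀ {n} (K : Gr n) S {u v} → T (E (restrict K S) u v) →
  T (E K u v) × ¬ T (S u) × ¬ T (S v)
restrict-E K S {u} {v} t =
  ∧-l {E K u v} t ,
  not-elim (∧-l {not (S u)} (∧-r {E K u v} t)) ,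
  not-elim (∧-r {not (S u)} (∧-r {E K u v} t))

firstEntry : ∀ {n} (K : Gr n) (S : Fin n → Bool) {a b} → ¬ T (S a) → T (S b) → Walk K a b →
  Σ (Fin n) λ u → Σ (Fin n) λ t →
    ¬ T (S u) × T (S t) × Walk (restrict K S) a u × T (E K u t)
firstEntry K S ¬Sa Sb (here _) = ⊥-elim (¬Sa Sb)
firstEntry K S {a} ¬Sa Sb (step {_} {c} e r) with T? (S c)
... | yes Sc = a , c , ¬Sa , Sc , here a , e
... | no ¬Sc with firstEntry K S ¬Sc Sb r
... | u , t , ¬Su , St , W , ut =
  u , t , ¬Su , St , step (∧-intro e (∧-intro (not-intro ¬Sa) (not-intro ¬Sc))) W , ut

D≢ : ∀ {n} (D : Fin n → Bool) {a b} → T (D a) → ¬ T (D b) → a ≢ b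
D≢ D Da ¬Db a≡b = ¬Db (subst (λ z → T (D z)) a≡b Da)

-- Consequences of minimality: no edge between two vertices outside D, and no
-- vertex outside D, can be deleted while keeping the graph bridgeless connected
-- (the remaining conditions of a minimal subgraph are then automatic).
module Minimality {n} {G' : Gr n} {D : Fin n → Bool} {f : Fin n → Fin n} {G : Gr n}
  (dom : IsDomFun G' D f) (minimal : MinimalSubgraph G' D f G) where

  private
    wf  = proj₁ (proj₁ minimal)
    sub = proj₁ (proj₂ (proj₁ minimal))
    D⊆V = proj₁ (proj₂ (proj₂ (proj₁ minimal)))
    fE  = proj₂ (proj₂ (proj₂ (proj₂ (proj₁ minimal))))
    least = proj₂ minimal

    fD : ∀ {v} → ¬ T (D v) → T (D (f v))
    fD ¬Dv = proj₁ (dom _ ¬Dv)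

  edge-irremovable : ∀ c d → T (E G c d) → ¬ T (D c) → ¬ T (D d) →
    ¬ BridgelessConnected (deleteEdge G c d)
  edge-irremovable c d cd ¬Dc ¬Dd bcH =
    proj₁ (delE-ne G c d (subst T (sym (proj₂ same c d)) cd)) (refl , refl)
    where
    H = deleteEdge G c d
    fE-H : ∀ v → T (V H v) → ¬ T (D v) → T (E H v (f v))
    fE-H v Vv ¬Dv = delE-intro G c d (fE v Vv ¬Dv)
      (edgeNe-snd (D≢ D (fD ¬Dv) ¬Dc) (D≢ D (fD ¬Dv) ¬Dd))
    same : SameGraph H G
    same = least H ((λ v t → t) , (λ u v t → delE-E G c d t))
      (wfDelE c d wf , ((λ v t → proj₁ sub v t) , (λ u v t → proj₂ sub u v (delE-E G c d t))) ,
       D⊆V , bcH , fE-H)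

  vertex-irremovable : ∀ y → T (V G y) → ¬ T (D y) → ¬ BridgelessConnected (deleteVertex G y)
  vertex-irremovable y Vy ¬Dy bcH = delV-Vne G y (subst T (sym (proj₁ same y)) Vy) refl
    where
    H = deleteVertex G y
    fE-H : ∀ v → T (V H v) → ¬ T (D v) → T (E H v (f v))
    fE-H v Vv ¬Dv = delV-intro G y (fE v (delV-V G y Vv) ¬Dv) (delV-Vne G y Vv) (D≢ D (fD ¬Dv) ¬Dy)
    same : SameGraph H G
    same = least H ((λ v t → delV-V G y t) , (λ u v t → delV-E G y t))
      (wfDelV y wf ,
       ((λ v t → proj₁ sub v (delV-V G y t)) , (λ u v t → proj₂ sub u v (delV-E G y t))) ,
       (λ v Dv → delV-Vintro G y (D⊆V v Dv) (λ e → ¬Dy (subst (λ z → T (D z)) e Dv))) ,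
       bcH , fE-H)

record Config {n} (G : Gr n) (x y₁ y₂ w w' : Fin n) : Set where
  field
    xy₁ : T (E G x y₁)
    xy₂ : T (E G x y₂)
    y₁w : T (E G y₁ w)
    y₂w : T (E G y₂ w)
    xw' : T (E G x w')
    x≢y₁ : x ≢ y₁
    x≢y₂ : x ≢ y₂
    y₁≢y₂ : y₁ ≢ y₂
    w≢x : w ≢ x
    w≢y₁ : w ≢ y₁
    w≢y₂ : w ≢ y₂
    w'≢x : w' ≢ x
    w'≢y₁ : w' ≢ y₁
    w'≢y₂ : w' ≢ y₂
    w'≢w : w' ≢ w

swapConfig : ∀ {n} {G : Gr n} {x y₁ y₂ w w'} → Config G x y₁ y₂ w w' → Config G x y₂ y₁ w w'
swapConfig c = record
  { xy₁ = xy₂ ; xy₂ = xy₁ ; y₁w = y₂w ; y₂w = y₁w ; xw' = xw'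
  ; x≢y₁ = x≢y₂ ; x≢y₂ = x≢y₁ ; y₁≢y₂ = ≢-sym y₁≢y₂
  ; w≢x = w≢x ; w≢y₁ = w≢y₂ ; w≢y₂ = w≢y₁
  ; w'≢x = w'≢x ; w'≢y₁ = w'≢y₂ ; w'≢y₂ = w'≢y₁ ; w'≢w = w'≢w }
  where open Config c

module Reduction {n} {G : Gr n} (wf : WellFormed G) (bc : BridgelessConnected G)
  {x y₁ y₂ w w' : Fin n} (cfg : Config G x y₁ y₂ w w') where

  open Config cfg
  private
    sG = symmetric wf

  Outside : Fin n → Set
  Outside p = p ≢ x × p ≢ y₁ × p ≢ y₂ × p ≢ w

  record Detour (t : Fin n) : Set where
    field
      A         : Gr n
      A-outside : ∀ {p q} → T (E A p q) → T (E G p q) × Outside p × Outside q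
      u         : Fin n
      path      : Walk A w' u
      u-outside : Outside u
      ut        : T (E G u t)

  throughDetour : ∀ {L : Gr n} {t} (det : Detour t) →
    (∀ {p q} → T (E G p q) → Outside p → Outside q → T (E L p q)) →
    T (E L x w') → T (E L (Detour.u det) t) → Walk L x t
  throughDetour det keep xw'L utL =
    step xw'L (mono (λ e → let (eG , op , oq) = A-outside e in keep eG op oq) path
               ++ step utL (here _))
    where open Detour det

  -- A detour entering at y₁: the cycle x y₂ w y₁ and the cycle x w' ⋯ u y₁ share
  -- only the edge xy₁, so G − xy₁ stays bridgeless.  Z = {w, y₂} separates them.
  reduce-at-y₁ : Detour y₁ → BridgelessConnected (deleteEdge G x y₁)
  reduce-at-y₁ det = bridgeless-deleteEdge wf bc xy₁ route
    where
    open Detour det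
    Z : Fin n → Set
    Z p = p ≡ w ⊎ p ≡ y₂
    ¬Z : ∀ {p} → p ≢ w → p ≢ y₂ → ¬ Z p
    ¬Z p≢w _ (inj₁ e) = p≢w e
    ¬Z _ p≢y₂ (inj₂ e) = p≢y₂ e
    route : ∀ a b → T (E G a b) → Walk (deleteEdge (deleteEdge G x y₁) a b) x y₁
    route a b _ with (a ≟ w ⊎-dec a ≟ y₂) ⊎-dec (b ≟ w ⊎-dec b ≟ y₂)
    ... | yes ab∈Z = throughDetour det
      (λ e (p≢x , p≢y₁ , p≢y₂ , p≢w) (_ , _ , q≢y₂ , q≢w) →
         delEE-intro G e (edgeNe-fst p≢x p≢y₁) (edgeNe-outside Z (¬Z p≢w p≢y₂) (¬Z q≢w q≢y₂) ab∈Z))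
      (delEE-intro G xw' (edgeNe-snd w'≢x w'≢y₁)
         (edgeNe-outside Z (¬Z (≢-sym w≢x) x≢y₂) (¬Z w'≢w w'≢y₂) ab∈Z))
      (delEE-intro G ut (edgeNe-fst u≢x u≢y₁)
         (edgeNe-outside Z (¬Z u≢w u≢y₂) (¬Z (≢-sym w≢y₁) y₁≢y₂) ab∈Z))
      where
      u≢x = proj₁ u-outside
      u≢y₁ = proj₁ (proj₂ u-outside)
      u≢y₂ = proj₁ (proj₂ (proj₂ u-outside))
      u≢w = proj₂ (proj₂ (proj₂ u-outside))
    ... | no ab∉Z =
      step (cycleEdge xy₂ (edgeNe-snd (≢-sym x≢y₂) (≢-sym y₁≢y₂)) (inj₂ (inj₂ refl)))
      (step (cycleEdge y₂w (edgeNe-fst (≢-sym x≢y₂) (≢-sym y₁≢y₂)) (inj₁ (inj₂ refl)))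
      (step (cycleEdge (sG y₁w) (edgeNe-fst w≢x w≢y₁) (inj₁ (inj₁ refl)))
      (here _)))
      where
      cycleEdge : ∀ {p q} → T (E G p q) → EdgeNe p q x y₁ → Z p ⊎ Z q →
        T (E (deleteEdge (deleteEdge G x y₁) a b) p q)
      cycleEdge e ne Zpq =
        delEE-intro G e ne (edgeNe-touching Z Zpq (λ Za → ab∉Z (inj₁ Za)) (λ Zb → ab∉Z (inj₂ Zb)))

  -- A detour entering at w, when y₁ has a further neighbour z ∉ {x,w} and
  -- G − y₁ is connected: of the routes x y₂ w y₁, x w' ⋯ u w y₁ and x ⋯ z y₁
  -- (the last through G − y₁), one avoids any given edge ab, so G − xy₁ stays
  -- bridgeless.  The first two are separated by {y₂}, the third avoids wy₁.
  reduce-at-w-edge : Detour w → Connected (deleteVertex G y₁) →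
    ∀ z → T (E G y₁ z) → z ≢ x → z ≢ w → BridgelessConnected (deleteEdge G x y₁)
  reduce-at-w-edge det cy₁ z y₁z z≢x z≢w = bridgeless-deleteEdge wf bc xy₁ route
    where
    open Detour det
    open WellFormed wf
    L : Fin n → Fin n → Gr n
    L a b = deleteEdge (deleteEdge G x y₁) a b

    z≢y₁ : z ≢ y₁
    z≢y₁ refl = subst T (E-irr y₁) y₁z

    x⋯z : Walk (deleteVertex G y₁) x z
    x⋯z = cy₁ x z (delV-Vintro G y₁ (E-V x y₁ xy₁) x≢y₁)
                  (delV-Vintro G y₁ (E-V z y₁ (sG y₁z)) z≢y₁)

    keepAway : ∀ {a b} → a ≡ y₁ ⊎ b ≡ y₁ →
      ∀ {p q} → T (E (deleteVertex G y₁) p q) → T (E (L a b) p q)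
    keepAway y₁∈ab e =
      delEE-intro G (delV-E G y₁ e) (edgeNe-outside (_≡ y₁) p≢y₁ q≢y₁ (inj₂ refl))
                                    (edgeNe-outside (_≡ y₁) p≢y₁ q≢y₁ y₁∈ab)
      where
      p≢y₁ = delV-ne₁ G y₁ e
      q≢y₁ = delV-ne₂ G y₁ e

    throughZ : ∀ {a b} → (a ≡ w × b ≡ y₁) ⊎ (a ≡ y₁ × b ≡ w) → Walk (L a b) x y₁
    throughZ (inj₁ (refl , refl)) =
      snoc (mono (keepAway (inj₂ refl)) x⋯z)
           (delEE-intro G (sG y₁z) (edgeNe-fst z≢x z≢y₁) (edgeNe-fst z≢w z≢y₁))
    throughZ (inj₂ (refl , refl)) =
      snoc (mono (keepAway (inj₁ refl)) x⋯z)
           (delEE-intro G (sG y₁z) (edgeNe-fst z≢x z≢y₁) (edgeNe-fst z≢y₁ z≢w))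

    route : ∀ a b → T (E G a b) → Walk (L a b) x y₁
    route a b _ with edge-trichotomy a b w y₁
    ... | inj₁ ab=wy₁        = throughZ (inj₁ ab=wy₁)
    ... | inj₂ (inj₁ ab=y₁w) = throughZ (inj₂ ab=y₁w)
    ... | inj₂ (inj₂ ab≠wy₁) with a ≟ y₂ ⊎-dec b ≟ y₂
    ...   | yes y₂∈ab =
      snoc (throughDetour det
              (λ e (p≢x , p≢y₁ , p≢y₂ , _) (_ , _ , q≢y₂ , _) →
                 delEE-intro G e (edgeNe-fst p≢x p≢y₁) (edgeNe-outside (_≡ y₂) p≢y₂ q≢y₂ y₂∈ab))
              (delEE-intro G xw' (edgeNe-snd w'≢x w'≢y₁) (edgeNe-outside (_≡ y₂) x≢y₂ w'≢y₂ y₂∈ab))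
              (delEE-intro G ut (edgeNe-fst u≢x u≢y₁) (edgeNe-outside (_≡ y₂) u≢y₂ w≢y₂ y₂∈ab)))
           wy₁
      where
      u≢x = proj₁ u-outside
      u≢y₁ = proj₁ (proj₂ u-outside)
      u≢y₂ = proj₁ (proj₂ (proj₂ u-outside))
      wy₁ = delEE-intro G (sG y₁w) (edgeNe-fst w≢x w≢y₁) (edgeNe-comm ab≠wy₁)
    ...   | no y₂∉ab =
      step (delEE-intro G xy₂ (edgeNe-snd (≢-sym x≢y₂) (≢-sym y₁≢y₂)) (avoidsY₂ (inj₂ refl)))
      (step (delEE-intro G y₂w (edgeNe-fst (≢-sym x≢y₂) (≢-sym y₁≢y₂)) (avoidsY₂ (inj₁ refl)))
      (step (delEE-intro G (sG y₁w) (edgeNe-fst w≢x w≢y₁) (edgeNe-comm ab≠wy₁))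
      (here _)))
      where
      avoidsY₂ : ∀ {p q} → p ≡ y₂ ⊎ q ≡ y₂ → EdgeNe p q a b
      avoidsY₂ y₂∈pq =
        edgeNe-touching (_≡ y₂) y₂∈pq (λ e → y₂∉ab (inj₁ e)) (λ e → y₂∉ab (inj₂ e))

  -- A detour entering at w, when x and w are the only neighbours of y₁ and
  -- G − y₁ is connected: the routes x y₂ w and x w' ⋯ u w are separated by
  -- {y₂}, so G − y₁ stays bridgeless.
  reduce-at-w-vertex : Detour w → (∀ {z} → T (E G y₁ z) → z ≡ x ⊎ z ≡ w) →
    Connected (deleteVertex G y₁) → BridgelessConnected (deleteVertex G y₁)
  reduce-at-w-vertex det nbrs cy₁ = bridgeless-deleteVertex wf bc nbrs x≢y₁ w≢y₁ cy₁ route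
    where
    open Detour det
    route : ∀ a b → T (E G a b) → Walk (deleteEdge (deleteVertex G y₁) a b) x w
    route a b _ with a ≟ y₂ ⊎-dec b ≟ y₂
    ... | yes y₂∈ab = throughDetour det
      (λ e (_ , p≢y₁ , p≢y₂ , _) (_ , q≢y₁ , q≢y₂ , _) →
         delVE-intro G e p≢y₁ q≢y₁ (edgeNe-outside (_≡ y₂) p≢y₂ q≢y₂ y₂∈ab))
      (delVE-intro G xw' x≢y₁ w'≢y₁ (edgeNe-outside (_≡ y₂) x≢y₂ w'≢y₂ y₂∈ab))
      (delVE-intro G ut u≢y₁ w≢y₁ (edgeNe-outside (_≡ y₂) u≢y₂ w≢y₂ y₂∈ab))
      where
      u≢y₁ = proj₁ (proj₂ u-outside)
      u≢y₂ = proj₁ (proj₂ (proj₂ u-outside))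
    ... | no y₂∉ab =
      step (delVE-intro G xy₂ x≢y₁ (≢-sym y₁≢y₂) (avoidsY₂ (inj₂ refl)))
      (step (delVE-intro G y₂w (≢-sym y₁≢y₂) w≢y₁ (avoidsY₂ (inj₁ refl)))
      (here _))
      where
      avoidsY₂ : ∀ {p q} → p ≡ y₂ ⊎ q ≡ y₂ → EdgeNe p q a b
      avoidsY₂ y₂∈pq =
        edgeNe-touching (_≡ y₂) y₂∈pq (λ e → y₂∉ab (inj₁ e)) (λ e → y₂∉ab (inj₂ e))

  private
    Core : Fin n → Bool
    Core v = v == y₁ ∨ v == y₂ ∨ v == w

    Core-elim : ∀ {v} → T (Core v) → v ≡ y₁ ⊎ v ≡ y₂ ⊎ v ≡ w
    Core-elim {v} t with ∨-elim {v == y₁} t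
    ... | inj₁ t₁ = inj₁ (==-elim t₁)
    ... | inj₂ t' with ∨-elim {v == y₂} t'
    ...   | inj₁ t₂ = inj₂ (inj₁ (==-elim t₂))
    ...   | inj₂ t₃ = inj₂ (inj₂ (==-elim t₃))

    ∉Core : ∀ {v} → ¬ T (Core v) → v ≢ y₁ × v ≢ y₂ × v ≢ w
    ∉Core {v} ¬C = (λ e → ¬C (∨-inl (==-intro e))) ,
                   (λ e → ¬C (∨-inr {v == y₁} (∨-inl (==-intro e)))) ,
                   (λ e → ¬C (∨-inr {v == y₁} (∨-inr {v == y₂} (==-intro e))))

    w∈Core : T (Core w)
    w∈Core = ∨-inr {w == y₁} (∨-inr {w == y₂} (==-intro refl))

    w'∉Core : ¬ T (Core w')
    w'∉Core t with Core-elim t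
    ... | inj₁ e        = w'≢y₁ e
    ... | inj₂ (inj₁ e) = w'≢y₂ e
    ... | inj₂ (inj₂ e) = w'≢w e

    w'⋯w : Connected (deleteVertex G x) → Walk (deleteVertex G x) w' w
    w'⋯w cx = cx w' w (delV-Vintro G x (WellFormed.E-V wf w' x (sG xw')) w'≢x)
                      (delV-Vintro G x (WellFormed.E-V wf w y₁ (sG y₁w)) w≢x)

  detour : Connected (deleteVertex G x) → Σ (Fin n) λ t → (t ≡ y₁ ⊎ t ≡ y₂ ⊎ t ≡ w) × Detour t
  detour cx with firstEntry (deleteVertex G x) Core w'∉Core w∈Core (w'⋯w cx)
  ... | u , t , u∉Core , t∈Core , path , ut =
    t , Core-elim t∈Core , record
      { A         = restrict (deleteVertex G x) Core
      ; A-outside = λ e → let (e' , p∉Core , q∉Core) = restrict-E (deleteVertex G x) Core e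
                          in delV-E G x e' , (delV-ne₁ G x e' , ∉Core p∉Core) ,
                                             (delV-ne₂ G x e' , ∉Core q∉Core)
      ; u         = u
      ; path      = path
      ; u-outside = delV-ne₁ G x ut , ∉Core u∉Core
      ; ut        = delV-E G x ut }

module Reduce {n} {G : Gr n} (wf : WellFormed G) (bc : BridgelessConnected G)
  {x y₁ y₂ w w' : Fin n} (cfg : Config G x y₁ y₂ w w') where

  open Reduction wf bc cfg
  module Swapped = Reduction wf bc (swapConfig cfg)

  swapDetour : ∀ {t} → Detour t → Swapped.Detour t
  swapDetour det = record
    { A         = A
    ; A-outside = λ e → let (eG , (p≢x , p≢y₁ , p≢y₂ , p≢w) , (q≢x , q≢y₁ , q≢y₂ , q≢w)) = A-outside e
                        in eG , (p≢x , p≢y₂ , p≢y₁ , p≢w) , (q≢x , q≢y₂ , q≢y₁ , q≢w)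
    ; u         = u
    ; path      = path
    ; u-outside = let (u≢x , u≢y₁ , u≢y₂ , u≢w) = u-outside in u≢x , u≢y₂ , u≢y₁ , u≢w
    ; ut        = ut }
    where open Detour det

  reduce : Connected (deleteVertex G x) → Connected (deleteVertex G y₁) →
    BridgelessConnected (deleteEdge G x y₁) ⊎ BridgelessConnected (deleteEdge G x y₂) ⊎
    BridgelessConnected (deleteVertex G y₁)
  reduce cx cy₁ with detour cx
  ... | _ , inj₁ refl , det        = inj₁ (reduce-at-y₁ det)
  ... | _ , inj₂ (inj₁ refl) , det = inj₂ (inj₁ (Swapped.reduce-at-y₁ (swapDetour det)))
  ... | _ , inj₂ (inj₂ refl) , det
    with any? (λ z → T? (E G y₁ z) ×-dec ¬? (z ≟ x) ×-dec ¬? (z ≟ w))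
  ...   | yes (z , y₁z , z≢x , z≢w) = inj₁ (reduce-at-w-edge det cy₁ z y₁z z≢x z≢w)
  ...   | no noOther = inj₂ (inj₂ (reduce-at-w-vertex det nbrs cy₁))
    where
    nbrs : ∀ {z} → T (E G y₁ z) → z ≡ x ⊎ z ≡ w
    nbrs {z} y₁z with z ≟ x | z ≟ w
    ... | yes z≡x | _       = inj₁ z≡x
    ... | no _    | yes z≡w = inj₂ z≡w
    ... | no z≢x  | no z≢w  = ⊥-elim (noOther (z , y₁z , z≢x , z≢w))

-- Under the hypotheses of the lemma with f y₁ = f y₂, the vertices x, y₁, y₂,
-- f y₁, f x form the configuration (distinctness comes from simplicity and
-- from f y₁, f x ∈ D while x, y₁, y₂ ∉ D).
configuration : ∀ {n} {G' : Gr n} {D f G} → IsDomFun G' D f → MinSubCond G' D f G →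
  ∀ {x y₁ y₂} → y₁ ≢ y₂ → T (V G x) → T (V G y₁) → T (V G y₂) →
  ¬ T (D x) → ¬ T (D y₁) → ¬ T (D y₂) → T (E G x y₁) → T (E G x y₂) →
  f y₁ ≢ f x → f y₁ ≡ f y₂ → Config G x y₁ y₂ (f y₁) (f x)
configuration {D = D} {G = G} dom (wf , _ , _ , _ , fE) {x} {y₁} {y₂}
  y₁≢y₂ Vx Vy₁ Vy₂ x∉D y₁∉D y₂∉D xy₁ xy₂ f₁≢fx f₁≡f₂ = record
  { xy₁ = xy₁ ; xy₂ = xy₂
  ; y₁w = fE y₁ Vy₁ y₁∉D
  ; y₂w = subst (λ z → T (E G y₂ z)) (sym f₁≡f₂) (fE y₂ Vy₂ y₂∉D)
  ; xw' = fE x Vx x∉D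
  ; x≢y₁ = loopless xy₁ ; x≢y₂ = loopless xy₂ ; y₁≢y₂ = y₁≢y₂
  ; w≢x = D≢ D w∈D x∉D ; w≢y₁ = D≢ D w∈D y₁∉D ; w≢y₂ = D≢ D w∈D y₂∉D
  ; w'≢x = D≢ D w'∈D x∉D ; w'≢y₁ = D≢ D w'∈D y₁∉D ; w'≢y₂ = D≢ D w'∈D y₂∉D
  ; w'≢w = ≢-sym f₁≢fx }
  where
  loopless : ∀ {a b} → T (E G a b) → a ≢ b
  loopless {a} ab refl = subst T (WellFormed.E-irr wf a) ab
  w∈D = proj₁ (dom y₁ y₁∉D)
  w'∈D = proj₁ (dom x x∉D)

-- With f y₁ = f y₂, x and y₁ cannot both be non-cut vertices: the reduction
-- would produce a proper subgraph still satisfying (1)-(3).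
cut-vertex-forced : ∀ {n} {G' : Gr n} {D f G} → IsDomFun G' D f → MinimalSubgraph G' D f G →
  ∀ {x y₁ y₂} → y₁ ≢ y₂ → T (V G x) → T (V G y₁) → T (V G y₂) →
  ¬ T (D x) → ¬ T (D y₁) → ¬ T (D y₂) → T (E G x y₁) → T (E G x y₂) →
  f y₁ ≢ f x → f y₁ ≡ f y₂ →
  Connected (deleteVertex G x) → Connected (deleteVertex G y₁) → ⊥
cut-vertex-forced dom minimal {x} {y₁} {y₂}
  y₁≢y₂ Vx Vy₁ Vy₂ x∉D y₁∉D y₂∉D xy₁ xy₂ f₁≢fx f₁≡f₂ cx cy₁ =
  [ edge-irremovable x y₁ xy₁ x∉D y₁∉D ,
  [ edge-irremovable x y₂ xy₂ x∉D y₂∉D ,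
    vertex-irremovable y₁ Vy₁ y₁∉D ] ] (Reduce.reduce wf bc cfg cx cy₁)
  where
  open Minimality dom minimal
  wf = proj₁ (proj₁ minimal)
  bc = proj₁ (proj₂ (proj₂ (proj₂ (proj₁ minimal))))
  cfg = configuration dom (proj₁ minimal)
          y₁≢y₂ Vx Vy₁ Vy₂ x∉D y₁∉D y₂∉D xy₁ xy₂ f₁≢fx f₁≡f₂

-- Lemma 16.  If f y₁ = f y₂ and neither x nor y₁ is a cut vertex we reach a
-- contradiction; connectivity is decidable, so the case split is constructive.
lemma16 : ∀ {n} (G' : Gr n) (D : Fin n → Bool) (f : Fin n → Fin n) →
    FirstStandardForm G' D → IsDomFun G' D f →
    (G : Gr n) → MinimalSubgraph G' D f G →
    (x y₁ y₂ : Fin n) → y₁ ≢ y₂ →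
    T (V G x) → T (V G y₁) → T (V G y₂) →
    ¬ T (D x) → ¬ T (D y₁) → ¬ T (D y₂) →
    T (E G x y₁) → T (E G x y₂) →
    f y₁ ≢ f x → f x ≢ f y₂ →
    (CutVertex G x ⊎ CutVertex G y₁ ⊎ CutVertex G y₂) ⊎ f y₁ ≢ f y₂
lemma16 G' D f _ dom G minimal x y₁ y₂ y₁≢y₂ Vx Vy₁ Vy₂ x∉D y₁∉D y₂∉D xy₁ xy₂ f₁≢fx _
  with f y₁ ≟ f y₂
... | no f₁≢f₂ = inj₂ f₁≢f₂
... | yes f₁≡f₂ with connected? (deleteVertex G x) | connected? (deleteVertex G y₁)
...   | no ¬cx  | _        = inj₁ (inj₁ (Vx , ¬cx))
...   | yes _   | no ¬cy₁  = inj₁ (inj₂ (inj₁ (Vy₁ , ¬cy₁)))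
...   | yes cx  | yes cy₁  = ⊥-elim (cut-vertex-forced dom minimal
          y₁≢y₂ Vx Vy₁ Vy₂ x∉D y₁∉D y₂∉D xy₁ xy₂ f₁≢fx f₁≡f₂ cx cy₁)
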